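{- For $n\ge 3$, let $Q_{2^n}$ be the generalized quaternion group of order $2^n$. Then $\kappa(\mathcal{G}_e(Q_{2^n}))=2$, and the number of connected components of $\mathcal{G}^{**}_e(Q_{2^n})$ is $2^{n-2}+1$.
   Context: The generalized quaternion group of order $2^n$ is $Q_{2^n}=\langle x,y \mid x^{2^{n-1}}=1,\ y^2=x^{2^{n-2}},\ yxy^{ -1}=x^{ -1}\rangle$ (so $x$ has order $2^{n-1}$, $y$ has order $4$, every element is $x^a$ or $x^ay$). For a finite group $G$, the enhanced power graph $\mathcal{G}_e(G)$ is the simple graph with vertex set $G$ in which two distinct vertices $u,v$ are adjacent if and only if there exists $w\in G$ such that both $u$ and $v$ are powers of $w$. For a graph $\Gamma$, the vertex connectivity $\kappa(\Gamma)$ is the minimum number of vertices whose removal leaves an induced subgraph that is disconnected. A dominating vertex is a vertex adjacent to every other vertex; $\mathcal{G}^{**}_e(G)$ is the induced subgraph of $\mathcal{G}_e(G)$ obtained by deleting all dominating vertices. -}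

module Defs where

open import Data.Nat using (ℕ; zero; suc; _+_; _∸_; _^_; _<_; NonZero)
open import Data.Nat.Properties using (m^n≢0)
open import Data.Nat.DivMod using (_mod_)
open import Data.Fin using (Fin; toℕ)
open import Data.Bool using (Bool; true; false; _xor_; _∧_; if_then_else_)
open import Data.Product using (Σ; ∃; ∃-syntax; _×_; _,_; proj₁)
open import Data.List using (List; length)
open import Data.List.Membership.Propositional using (_∈_)
open import Data.List.Relation.Unary.Unique.Propositional using (Unique)
open import Relation.Nullary using (¬_)
open import Relation.Binary.PropositionalEquality using (_≡_; _≢_)
open import Function.Bundles using (_⇔_)
open import Function.Definitions using (Surjective)

-- Generalized quaternion group Q_{2^n}
-- Element (a , b) represents x^a y^b, with a : Fin (2^(n-1)), b : Bool
-- (b = true means the factor y is present).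

ord-x : ℕ → ℕ
ord-x n = 2 ^ (n ∸ 1)

ord-x-nonZero : ∀ n → NonZero (ord-x n)
ord-x-nonZero n = m^n≢0 2 (n ∸ 1)

Q : ℕ → Set
Q n = Fin (ord-x n) × Bool

-- x^a y^b · x^c y^d = x^(a + (-1)^b c + [b ∧ d]·2^(n-2)) y^(b xor d)
-- using y x^c = x^(-c) y and y^2 = x^(2^(n-2)).
mul : ∀ n → Q n → Q n → Q n
mul n (a , b) (c , d) =
  ((toℕ a
     + (if b then (ord-x n ∸ toℕ c) else toℕ c)
     + (if b ∧ d then 2 ^ (n ∸ 2) else 0)) mod ord-x n) {{ord-x-nonZero n}}
  , (b xor d)

one : ∀ n → Q n
one n = (_mod_ 0 (ord-x n) {{ord-x-nonZero n}}) , false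

pow : ∀ n → Q n → ℕ → Q n
pow n w zero    = one n
pow n w (suc k) = mul n w (pow n w k)

IsPowerOf : ∀ n → Q n → Q n → Set
IsPowerOf n u w = ∃[ k ] u ≡ pow n w k

EnhAdj : ∀ n → Q n → Q n → Set
EnhAdj n u v = u ≢ v × ∃[ w ] (IsPowerOf n u w × IsPowerOf n v w)

module _ {V : Set} (Adj : V → V → Set) where

  data Path (P : V → Set) : V → V → Set where
    here : ∀ {u} → P u → Path P u u
    step : ∀ {u w v} → P u → Adj u w → Path P w v → Path P u v

  IsSeparatingSet : List V → Set
  IsSeparatingSet S =
    ∃[ u ] ∃[ v ] (¬ (u ∈ S) × ¬ (v ∈ S) × ¬ Path (λ x → ¬ (x ∈ S)) u v)

  VertexConnectivity : ℕ → Set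
  VertexConnectivity k =
    (∃[ S ] (Unique S × length S ≡ k × IsSeparatingSet S))
    × (∀ (S : List V) → length S < k → ¬ IsSeparatingSet S)

  Dominating : V → Set
  Dominating u = ∀ v → u ≢ v → Adj u v

  -- the induced subgraph on vertices satisfying P has exactly k
  -- connected components: a surjective labelling by Fin k whose fibres
  -- are exactly the connected components
  NumComponents : (P : V → Set) → ℕ → Set
  NumComponents P k =
    Σ (Σ V P → Fin k) λ c →
      Surjective _≡_ _≡_ c
      × (∀ (u v : Σ V P) → (c u ≡ c v) ⇔ Path P (proj₁ u) (proj₁ v))

module Submission where

-- Write N = 2^(n-1) = 2h for the order of x and z = x^h for the unique
-- involution.  Every power of an element x^a y lies in {1, x^a y, z, x^(a+h) y},
-- and every power of x^a lies in ⟨x⟩.  Hence 1 and z are dominating, and any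
-- edge between two vertices outside {1, z} joins vertices with the same label,
-- where the label of x^a is h and the label of x^a y is a mod h.  Conversely
-- vertices with equal labels are adjacent (through x, resp. through x^a y).
--
-- The theorem
-- follows: {1, z} separates x from y, while a set of fewer than two vertices
-- misses a dominating vertex; and the labels 0, …, h number the components
-- left after deleting 1 and z, which are exactly the dominating vertices.

open import Defs
open import Data.Nat using (ℕ; zero; suc; _≤_; _<_; _+_; _*_; _∸_; _^_; _%_; NonZero; z≤n; s≤s; _<?_)
open import Data.Nat.Properties
open import Data.Nat.DivMod using (%-distribˡ-+; m%n%n≡m%n; [m+n]%n≡m%n; m<n⇒m%n≡m; m≤n⇒[n∸m]%m≡n%m; m∣n⇒o%n%m≡o%m; m%n<n; n%n≡0)
open import Data.Nat.Divisibility using (divides)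
open import Data.Fin using (Fin; toℕ; fromℕ<)
open import Data.Fin.Properties using (toℕ-injective; toℕ-fromℕ<; toℕ<n)
import Data.Fin as Fin
import Data.Bool as Bool
open import Data.Bool using (true; false)
open import Data.Product using (Σ; ∃; _×_; _,_; proj₁; proj₂)
open import Data.Product.Properties using (≡-dec)
open import Data.Sum using (_⊎_; inj₁; inj₂)
open import Data.List using (List; []; _∷_; length)
open import Data.List.Relation.Unary.Any using (here; there)
open import Data.List.Relation.Unary.All using ([]; _∷_)
open import Data.List.Relation.Unary.AllPairs using ([]; _∷_)
open import Data.List.Membership.Propositional using (_∈_)
open import Data.Empty using (⊥-elim)
open import Relation.Nullary using (¬_; Dec; yes; no)
open import Relation.Binary.PropositionalEquality
open import Function.Bundles using (mk⇔)

module GraphFacts {V : Set} (Adj : V → V → Set)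
                  (_≟_ : (u v : V) → Dec (u ≡ v))
                  (adj-sym : ∀ {u v} → Adj u v → Adj v u) where

  path-start : ∀ {P : V → Set} {u v} → Path Adj P u v → P u
  path-start (here p)     = p
  path-start (step p _ _) = p

  label-constant : ∀ {A : Set} {P : V → Set} (ℓ : V → A) →
    (∀ {u w} → P u → P w → Adj u w → ℓ u ≡ ℓ w) →
    ∀ {u v} → Path Adj P u v → ℓ u ≡ ℓ v
  label-constant ℓ edge (here _)        = refl
  label-constant ℓ edge (step pu a p)   = trans (edge pu (path-start p) a) (label-constant ℓ edge p)

  path-if-adjacent : ∀ {P : V → Set} {u v} → P u → P v → (u ≢ v → Adj u v) → Path Adj P u v
  path-if-adjacent {u = u} {v} pu pv adj with u ≟ v
  ... | yes refl = here pu
  ... | no u≢v   = step pu (adj u≢v) (here pv)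

  path-via-dominating : ∀ {P : V → Set} {c u v} → Dominating Adj c → P c → P u → P v → Path Adj P u v
  path-via-dominating {P} {c} {u} {v} dom pc pu pv with u ≟ c
  ... | yes refl = path-if-adjacent pc pv (dom v)
  ... | no u≢c   = step pu (adj-sym (dom u (λ c≡u → u≢c (sym c≡u)))) (path-if-adjacent pc pv (dom v))

  not-separating-if-dominating-kept : ∀ {c} S → Dominating Adj c → ¬ (c ∈ S) → ¬ IsSeparatingSet Adj S
  not-separating-if-dominating-kept S dom c∉S (u , v , u∉S , v∉S , no-path) =
    no-path (path-via-dominating dom c∉S u∉S v∉S)

  short-list-misses : ∀ {c d} (S : List V) → c ≢ d → length S < 2 → ¬ (c ∈ S) ⊎ ¬ (d ∈ S)
  short-list-misses []          c≢d _ = inj₁ λ ()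
  short-list-misses {c} {d} (s ∷ []) c≢d _ with s ≟ c
  ... | yes refl = inj₂ λ { (here d≡c) → c≢d (sym d≡c) }
  ... | no s≢c   = inj₁ λ { (here c≡s) → s≢c (sym c≡s) }
  short-list-misses (_ ∷ _ ∷ _) _ (s≤s (s≤s ()))

  components-by-label : (P : V → Set) (k : ℕ) (ℓ : V → ℕ) →
    (∀ u → ℓ u < k) →
    (∀ j → j < k → Σ V λ u → P u × ℓ u ≡ j) →
    (∀ {u v} → Path Adj P u v → ℓ u ≡ ℓ v) →
    (∀ {u v} → P u → P v → ℓ u ≡ ℓ v → Path Adj P u v) →
    NumComponents Adj P k
  components-by-label P k ℓ ℓ<k hits sound complete = colour , surjective , λ u v → mk⇔
      (λ e → complete (proj₂ u) (proj₂ v) (label-of-colour u v e))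
      (λ p → toℕ-injective (trans (toℕ-fromℕ< _) (trans (sound p) (sym (toℕ-fromℕ< _)))))
    where
    colour : Σ V P → Fin k
    colour (u , _) = fromℕ< (ℓ<k u)

    label-of-colour : ∀ u v → colour u ≡ colour v → ℓ (proj₁ u) ≡ ℓ (proj₁ v)
    label-of-colour u v e = trans (sym (toℕ-fromℕ< _)) (trans (cong toℕ e) (toℕ-fromℕ< _))

    surjective : ∀ j → ∃ λ u → ∀ {w} → w ≡ u → colour w ≡ j
    surjective j with hits (toℕ j) (toℕ<n j)
    ... | u , pu , ℓu≡j = (u , pu) , λ { refl → toℕ-injective (trans (toℕ-fromℕ< _) ℓu≡j) }

%-absorbʳ : ∀ x y d .{{_ : NonZero d}} → (x + y % d) % d ≡ (x + y) % d
%-absorbʳ x y d = begin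
  (x + y % d) % d          ≡⟨ %-distribˡ-+ x (y % d) d ⟩
  (x % d + y % d % d) % d  ≡⟨ cong (λ t → (x % d + t) % d) (m%n%n≡m%n y d) ⟩
  (x % d + y % d) % d      ≡⟨ %-distribˡ-+ x y d ⟨
  (x + y) % d              ∎
  where open ≡-Reasoning

module HalfModulus (h : ℕ) .{{h≢0 : NonZero h}} where

  private instance
    2h≢0 : NonZero (2 * h)
    2h≢0 = m*n≢0 2 h

  2h≡h+h : 2 * h ≡ h + h
  2h≡h+h = cong (h +_) (+-identityʳ h)

  upper-half-%h : ∀ x → h ≤ x → x < 2 * h → x % h ≡ x ∸ h
  upper-half-%h x h≤x x<2h = trans (sym (m≤n⇒[n∸m]%m≡n%m h≤x))
    (m<n⇒m%n≡m (m<n+o⇒m∸n<o x h (subst (x <_) 2h≡h+h x<2h)))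

  congruent-distinct⇒shift : ∀ a b → a < 2 * h → b < 2 * h →
    a % h ≡ b % h → a ≢ b → (a + h) % (2 * h) ≡ b
  congruent-distinct⇒shift a b a<2h b<2h a≡b a≢b with a <? h | b <? h
  ... | yes a<h | yes b<h = ⊥-elim (a≢b (trans (sym (m<n⇒m%n≡m a<h)) (trans a≡b (m<n⇒m%n≡m b<h))))
  ... | yes a<h | no b≮h = begin
      (a + h) % (2 * h)  ≡⟨ m<n⇒m%n≡m (subst (a + h <_) (sym 2h≡h+h) (+-monoˡ-< h a<h)) ⟩
      a + h              ≡⟨ cong (_+ h) (trans (sym (m<n⇒m%n≡m a<h)) (trans a≡b (upper-half-%h b (≮⇒≥ b≮h) b<2h))) ⟩
      b ∸ h + h          ≡⟨ m∸n+n≡m (≮⇒≥ b≮h) ⟩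
      b                  ∎
    where open ≡-Reasoning
  ... | no a≮h | yes b<h = begin
      (a + h) % (2 * h)          ≡⟨ cong (λ t → (t + h) % (2 * h)) (sym (m∸n+n≡m (≮⇒≥ a≮h))) ⟩
      (a ∸ h + h + h) % (2 * h)  ≡⟨ cong (_% (2 * h)) (trans (+-assoc (a ∸ h) h h) (cong₂ _+_ a∸h≡b (sym 2h≡h+h))) ⟩
      (b + 2 * h) % (2 * h)      ≡⟨ [m+n]%n≡m%n b (2 * h) ⟩
      b % (2 * h)                ≡⟨ m<n⇒m%n≡m b<2h ⟩
      b                          ∎
    where
    open ≡-Reasoning
    a∸h≡b : a ∸ h ≡ b
    a∸h≡b = trans (sym (upper-half-%h a (≮⇒≥ a≮h) a<2h)) (trans a≡b (m<n⇒m%n≡m b<h))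
  ... | no a≮h | no b≮h = ⊥-elim (a≢b (begin
      a          ≡⟨ m∸n+n≡m (≮⇒≥ a≮h) ⟨
      a ∸ h + h  ≡⟨ cong (_+ h) (trans (sym (upper-half-%h a (≮⇒≥ a≮h) a<2h)) (trans a≡b (upper-half-%h b (≮⇒≥ b≮h) b<2h))) ⟩
      b ∸ h + h  ≡⟨ m∸n+n≡m (≮⇒≥ b≮h) ⟩
      b          ∎))
    where open ≡-Reasoning

module Quaternion (m : ℕ) where

  n h N : ℕ
  n = 3 + m
  h = 2 ^ suc m
  N = ord-x n

  instance
    h≢0 : NonZero h
    h≢0 = m^n≢0 2 (suc m)
    N≢0 : NonZero N
    N≢0 = ord-x-nonZero n

  open HalfModulus h

  G : Set
  G = Q n

  _·_ : G → G → G
  _·_ = mul n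

  e : G
  e = one n

  Adj : G → G → Set
  Adj = EnhAdj n

  index : G → ℕ
  index u = toℕ (proj₁ u)

  ext : ∀ {a b : Fin N} {s} → toℕ a ≡ toℕ b → _≡_ {A = G} (a , s) (b , s)
  ext a≡b = cong (_, _) (toℕ-injective a≡b)

  _≟G_ : (u v : G) → Dec (u ≡ v)
  _≟G_ = ≡-dec Fin._≟_ Bool._≟_

  adj-sym : ∀ {u v} → Adj u v → Adj v u
  adj-sym (u≢v , w , u∈⟨w⟩ , v∈⟨w⟩) = (λ v≡u → u≢v (sym v≡u)) , w , v∈⟨w⟩ , u∈⟨w⟩

  open GraphFacts Adj _≟G_ adj-sym

  0<h : 0 < h
  0<h = m^n>0 2 (suc m)

  2≤h : 2 ≤ h
  2≤h = *-monoʳ-≤ 2 (m^n>0 2 m)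

  h<N : h < N
  h<N = subst (h <_) (sym 2h≡h+h) (m<m+n h 0<h)

  0<N : 0 < N
  0<N = <-trans 0<h h<N

  1<N : 1 < N
  1<N = <-≤-trans (s≤s (s≤s z≤n)) (≤-trans 2≤h (<⇒≤ h<N))

  x y z : G
  x = fromℕ< 1<N , false
  y = fromℕ< 0<N , true
  z = fromℕ< h<N , false

  index-one : index e ≡ 0
  index-one = trans (toℕ-fromℕ< _) (m<n⇒m%n≡m 0<N)

  -- 1 is a right identity; this identifies the first power w¹ = w · 1 with w.
  ·-identityʳ : ∀ u → u · e ≡ u
  ·-identityʳ (a , false) = ext (trans (toℕ-fromℕ< _) (begin
    (toℕ a + index e + 0) % N  ≡⟨ cong (λ t → (toℕ a + t + 0) % N) index-one ⟩
    (toℕ a + 0 + 0) % N        ≡⟨ cong (_% N) (trans (+-identityʳ _) (+-identityʳ _)) ⟩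
    toℕ a % N                  ≡⟨ m<n⇒m%n≡m (toℕ<n a) ⟩
    toℕ a                      ∎))
    where open ≡-Reasoning
  ·-identityʳ (a , true) = ext (trans (toℕ-fromℕ< _) (begin
    (toℕ a + (N ∸ index e) + 0) % N  ≡⟨ cong (λ t → (toℕ a + (N ∸ t) + 0) % N) index-one ⟩
    (toℕ a + N + 0) % N              ≡⟨ cong (_% N) (+-identityʳ _) ⟩
    (toℕ a + N) % N                  ≡⟨ [m+n]%n≡m%n (toℕ a) N ⟩
    toℕ a % N                        ≡⟨ m<n⇒m%n≡m (toℕ<n a) ⟩
    toℕ a                            ∎))
    where open ≡-Reasoning

  sort-pow-x-type : ∀ c k → proj₂ (pow n (c , false) k) ≡ false
  sort-pow-x-type c zero    = refl
  sort-pow-x-type c (suc k) = sort-pow-x-type c k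

  index-pow-x : ∀ k → index (pow n x k) ≡ k % N
  index-pow-x zero    = toℕ-fromℕ< _
  index-pow-x (suc k) = trans (toℕ-fromℕ< _) (begin
    (index x + index (pow n x k) + 0) % N  ≡⟨ cong₂ (λ s t → (s + t + 0) % N) (toℕ-fromℕ< 1<N) (index-pow-x k) ⟩
    (1 + k % N + 0) % N                    ≡⟨ cong (_% N) (+-identityʳ _) ⟩
    (1 + k % N) % N                        ≡⟨ %-absorbʳ 1 k N ⟩
    suc k % N                              ∎)
    where open ≡-Reasoning

  x-generates : ∀ a → IsPowerOf n (a , false) x
  x-generates a = toℕ a , cong₂ _,_
    (toℕ-injective (sym (trans (index-pow-x (toℕ a)) (m<n⇒m%n≡m (toℕ<n a)))))
    (sym (sort-pow-x-type _ (toℕ a)))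

  y-square : ∀ a → (a , true) · (a , true) ≡ z
  y-square a = ext (trans (toℕ-fromℕ< _) (begin
    (toℕ a + (N ∸ toℕ a) + h) % N  ≡⟨ cong (λ t → (t + h) % N) (m+[n∸m]≡n (<⇒≤ (toℕ<n a))) ⟩
    (N + h) % N                    ≡⟨ cong (_% N) (+-comm N h) ⟩
    (h + N) % N                    ≡⟨ [m+n]%n≡m%n h N ⟩
    h % N                          ≡⟨ m<n⇒m%n≡m h<N ⟩
    h                              ≡⟨ toℕ-fromℕ< h<N ⟨
    index z                        ∎))
    where open ≡-Reasoning

  index-yz : ∀ a → index ((a , true) · z) ≡ (toℕ a + h) % N
  index-yz a = trans (toℕ-fromℕ< _) (cong (_% N) (begin
    toℕ a + (N ∸ index z) + 0  ≡⟨ +-identityʳ _ ⟩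
    toℕ a + (N ∸ index z)      ≡⟨ cong (λ t → toℕ a + (N ∸ t)) (toℕ-fromℕ< h<N) ⟩
    toℕ a + (N ∸ h)            ≡⟨ cong (toℕ a +_) (trans (cong (_∸ h) 2h≡h+h) (m+n∸n≡m h h)) ⟩
    toℕ a + h                  ∎))
    where open ≡-Reasoning

  -- (x^a y)⁴ = 1, written as x^a y · x^(a+h) y = 1.
  y-fourth : ∀ a → (a , true) · ((a , true) · z) ≡ e
  y-fourth a = ext (trans (toℕ-fromℕ< _) (begin
    (A + (N ∸ t) + h) % N        ≡⟨ cong (_% N) (trans (cong (_+ h) (+-comm A (N ∸ t))) (+-assoc (N ∸ t) A h)) ⟩
    ((N ∸ t) + (A + h)) % N      ≡⟨ %-absorbʳ (N ∸ t) (A + h) N ⟨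
    ((N ∸ t) + (A + h) % N) % N  ≡⟨ cong (λ s → ((N ∸ t) + s) % N) (index-yz a) ⟨
    ((N ∸ t) + t) % N            ≡⟨ cong (_% N) (m∸n+n≡m (<⇒≤ (toℕ<n (proj₁ ((a , true) · z))))) ⟩
    N % N                        ≡⟨ n%n≡0 N ⟩
    0                            ≡⟨ index-one ⟨
    index e                      ∎))
    where
    open ≡-Reasoning
    A t : ℕ
    A = toℕ a
    t = index ((a , true) · z)

  data InCyclicY (a : Fin N) : G → Set where
    is-one : InCyclicY a e
    is-gen : InCyclicY a (a , true)
    is-z   : InCyclicY a z
    is-gz  : InCyclicY a ((a , true) · z)

  y-powers : ∀ a k → InCyclicY a (pow n (a , true) k)
  y-powers a zero    = is-one
  y-powers a (suc k) = multiply (y-powers a k)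
    where
    multiply : ∀ {u} → InCyclicY a u → InCyclicY a ((a , true) · u)
    multiply is-one = subst (InCyclicY a) (sym (·-identityʳ _)) is-gen
    multiply is-gen = subst (InCyclicY a) (sym (y-square a)) is-z
    multiply is-z   = is-gz
    multiply is-gz  = subst (InCyclicY a) (sym (y-fourth a)) is-one

  y-cube : ∀ a → pow n (a , true) 3 ≡ (a , true) · z
  y-cube a = cong ((a , true) ·_) (trans (cong ((a , true) ·_) (·-identityʳ _)) (y-square a))

  -- The dominating vertices 1 and z: 1 is a power of everything, z is a
  -- power of x and of every x^a y.
  one-dominating : Dominating Adj e
  one-dominating v e≢v = e≢v , v , (0 , refl) , (1 , sym (·-identityʳ v))

  z-dominating : Dominating Adj z
  z-dominating (a , false) z≢v = z≢v , x , x-generates _ , x-generates a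
  z-dominating (a , true)  z≢v = z≢v , (a , true) ,
    (2 , trans (sym (y-square a)) (cong ((a , true) ·_) (sym (·-identityʳ _)))) ,
    (1 , sym (·-identityʳ _))

  NonCentral : G → Set
  NonCentral u = u ≢ e × u ≢ z

  e≢z : e ≢ z
  e≢z e≡z = <-irrefl (trans (sym index-one) (trans (cong index e≡z) (toℕ-fromℕ< h<N))) 0<h

  x-noncentral : NonCentral x
  x-noncentral =
    (λ x≡e → 0≢1+n (trans (sym index-one) (trans (cong index (sym x≡e)) (toℕ-fromℕ< 1<N)))) ,
    (λ x≡z → <-irrefl (trans (sym (toℕ-fromℕ< 1<N)) (trans (cong index x≡z) (toℕ-fromℕ< h<N))) 2≤h)

  y-type-noncentral : ∀ a → NonCentral (a , true)
  y-type-noncentral a = (λ ()) , (λ ())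

  label : G → ℕ
  label (a , false) = h
  label (a , true)  = toℕ a % h

  label-x-type : ∀ u → proj₂ u ≡ false → label u ≡ h
  label-x-type (a , false) _ = refl

  label-y-type<h : ∀ a → label (a , true) < h
  label-y-type<h a = m%n<n (toℕ a) h

  label≤h : ∀ u → label u < suc h
  label≤h (a , false) = ≤-refl
  label≤h (a , true)  = m<n⇒m<1+n (label-y-type<h a)

  -- x^a y and x^(a+h) y carry the same label since h divides N.
  label-gz : ∀ a → label ((a , true) · z) ≡ toℕ a % h
  label-gz a = begin
    index ((a , true) · z) % h  ≡⟨ cong (_% h) (index-yz a) ⟩
    (toℕ a + h) % N % h         ≡⟨ m∣n⇒o%n%m≡o%m h N (toℕ a + h) (divides 2 refl) ⟩
    (toℕ a + h) % h             ≡⟨ [m+n]%n≡m%n (toℕ a) h ⟩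
    toℕ a % h                   ∎
    where open ≡-Reasoning

  label-noncentral-y-power : ∀ {a u} → InCyclicY a u → NonCentral u → label u ≡ toℕ a % h
  label-noncentral-y-power is-one (u≢e , _) = ⊥-elim (u≢e refl)
  label-noncentral-y-power is-gen _         = refl
  label-noncentral-y-power is-z   (_ , u≢z) = ⊥-elim (u≢z refl)
  label-noncentral-y-power {a} is-gz _      = label-gz a

  adjacent⇒same-label : ∀ {u w} → NonCentral u → NonCentral w → Adj u w → label u ≡ label w
  adjacent⇒same-label _ _ (_ , (c , false) , (k , refl) , (j , refl)) =
    trans (label-x-type _ (sort-pow-x-type c k)) (sym (label-x-type _ (sort-pow-x-type c j)))
  adjacent⇒same-label nu nw (_ , (c , true) , (k , refl) , (j , refl)) =
    trans (label-noncentral-y-power (y-powers c k) nu) (sym (label-noncentral-y-power (y-powers c j) nw))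

  -- Distinct vertices with the same label are adjacent: through x on ⟨x⟩,
  -- and through x^a y when the other one is x^(a+h) y.
  same-label⇒adjacent : ∀ u v → label u ≡ label v → u ≢ v → Adj u v
  same-label⇒adjacent (a , false) (b , false) _ u≢v = u≢v , x , x-generates a , x-generates b
  same-label⇒adjacent (a , false) (b , true)  h≡b _ = ⊥-elim (<-irrefl (sym h≡b) (label-y-type<h b))
  same-label⇒adjacent (a , true)  (b , false) a≡h _ = ⊥-elim (<-irrefl a≡h (label-y-type<h a))
  same-label⇒adjacent (a , true)  (b , true)  a≡b u≢v =
    u≢v , (a , true) , (1 , sym (·-identityʳ _)) , (3 , sym (trans (y-cube a) v-is-gz))
    where
    v-is-gz : (a , true) · z ≡ (b , true)
    v-is-gz = ext (trans (index-yz a)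
      (congruent-distinct⇒shift (toℕ a) (toℕ b) (toℕ<n a) (toℕ<n b) a≡b (λ a≡b → u≢v (ext a≡b))))

  noncentral⇒not-dominating : ∀ u → NonCentral u → ¬ Dominating Adj u
  noncentral⇒not-dominating (a , false) nu dom =
    <-irrefl (sym (adjacent⇒same-label nu (y-type-noncentral _) (dom y (λ ())))) (label-y-type<h _)
  noncentral⇒not-dominating (a , true) nu dom =
    <-irrefl (adjacent⇒same-label nu x-noncentral (dom x (λ ()))) (label-y-type<h a)

  not-dominating⇒noncentral : ∀ {u} → ¬ Dominating Adj u → NonCentral u
  not-dominating⇒noncentral nd = (λ { refl → nd one-dominating }) , (λ { refl → nd z-dominating })

  central-pair : List G
  central-pair = e ∷ z ∷ []

  outside-central-pair : ∀ {w} → ¬ (w ∈ central-pair) → NonCentral w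
  outside-central-pair w∉ = (λ w≡e → w∉ (here w≡e)) , (λ w≡z → w∉ (there (here w≡z)))

  noncentral-outside : ∀ {w} → NonCentral w → ¬ (w ∈ central-pair)
  noncentral-outside (w≢e , _) (here w≡e)         = w≢e w≡e
  noncentral-outside (_ , w≢z) (there (here w≡z)) = w≢z w≡z

  -- Walks avoiding {1, z} keep the label, so they cannot join y to x.
  central-pair-separates : IsSeparatingSet Adj central-pair
  central-pair-separates =
    y , x , noncentral-outside (y-type-noncentral _) , noncentral-outside x-noncentral ,
    λ path → <-irrefl (label-constant label edge path) (label-y-type<h _)
    where
    edge : ∀ {u w} → ¬ (u ∈ central-pair) → ¬ (w ∈ central-pair) → Adj u w → label u ≡ label w
    edge u∉ w∉ = adjacent⇒same-label (outside-central-pair u∉) (outside-central-pair w∉)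

  -- {1, z} separates, while a smaller set keeps 1 or z and so separates nothing.
  vertex-connectivity : VertexConnectivity Adj 2
  vertex-connectivity =
    (central-pair , (e≢z ∷ []) ∷ [] ∷ [] , refl , central-pair-separates) , small-sets
    where
    small-sets : ∀ S → length S < 2 → ¬ IsSeparatingSet Adj S
    small-sets S |S|<2 with short-list-misses S e≢z |S|<2
    ... | inj₁ e∉S = not-separating-if-dominating-kept S one-dominating e∉S
    ... | inj₂ z∉S = not-separating-if-dominating-kept S z-dominating z∉S

  NonDominating : G → Set
  NonDominating u = ¬ Dominating Adj u

  components : NumComponents Adj NonDominating (h + 1)
  components = components-by-label NonDominating (h + 1) label
    (λ u → subst (label u <_) (+-comm 1 h) (label≤h u))
    hits
    (label-constant label λ pu pw → adjacent⇒same-label (not-dominating⇒noncentral pu) (not-dominating⇒noncentral pw))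
    (λ pu pv same → path-if-adjacent pu pv (same-label⇒adjacent _ _ same))
    where
    hits : ∀ j → j < h + 1 → Σ G λ u → NonDominating u × label u ≡ j
    hits j j<h+1 with m<1+n⇒m<n∨m≡n (subst (j <_) (+-comm h 1) j<h+1)
    ... | inj₁ j<h = (fromℕ< (<-trans j<h h<N) , true) ,
          noncentral⇒not-dominating _ (y-type-noncentral _) ,
          trans (cong (_% h) (toℕ-fromℕ< _)) (m<n⇒m%n≡m j<h)
    ... | inj₂ j≡h = x , noncentral⇒not-dominating x x-noncentral , sym j≡h

mainTheorem11 : (n : ℕ) → 3 ≤ n →
    VertexConnectivity (EnhAdj n) 2
    × NumComponents (EnhAdj n) (λ u → ¬ Dominating (EnhAdj n) u) (2 ^ (n ∸ 2) + 1)
mainTheorem11 (suc (suc (suc m))) _ = vertex-connectivity , components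
  where open Quaternion m
mainTheorem11 (suc zero)       (s≤s ())
mainTheorem11 (suc (suc zero)) (s≤s (s≤s ()))
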